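{- Let $\mathsf{G}$ and $\mathsf{G}'$ be well-formed global types. If there is a network $\mathsf{N}$ such that $\vdash \mathsf{N} : \mathsf{G}$ and $\vdash \mathsf{N} : \mathsf{G}'$, then $\mathcal{S}(\mathsf{G})=\mathcal{S}(\mathsf{G}')$ (the two event structures have the same set of events, the same causality relation and the same conflict relation).
   Context: Participants are ranged over by $\mathsf{p},\mathsf{q},\mathsf{r},\mathsf{s}$, messages (labels) by $\lambda$. Processes are the possibly infinite but regular (finitely many distinct subterms) terms generated coinductively by $P ::= \mathsf{p}!\{\lambda_i.P_i\}_{i\in I} \mid \mathsf{p}?\{\lambda_i.P_i\}_{i\in I} \mid \mathbf{0}$ (output choice towards $\mathsf{p}$, input choice from $\mathsf{p}$, inaction), with $I$ finite non-empty and $\lambda_h\neq\lambda_k$ for $h\neq k$. A network is $\mathsf{N}=\mathsf{p}_1[P_1]\parallel\cdots\parallel \mathsf{p}_n[P_n]$ with $n\ge1$ and pairwise distinct $\mathsf{p}_h$. Global types are the regular terms generated coinductively by $\mathsf{G} ::= \mathsf{p}\to\mathsf{q}:\{\lambda_i;\mathsf{G}_i\}_{i\in I} \mid \mathsf{End}$, with $I$ finite non-empty and $\lambda_h\neq\lambda_k$ for $h\ne k$. A communication is $\alpha=\mathsf{p}\mathsf{q}\lambda$, with $\mathrm{part}(\alpha)=\{\mathsf{p},\mathsf{q}\}$; a trace is a finite sequence of communications, $\mathrm{part}$ extended to traces by union. The set $\mathrm{Tr}(\mathsf{G})$ of traces of $\mathsf{G}$: $\mathrm{Tr}(\mathsf{End})=\emptyset$,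 and $\mathrm{Tr}(\mathsf{p}\to\mathsf{q}:\{\lambda_i;\mathsf{G}_i\}_{i\in I})$ consists of $\mathsf{p}\mathsf{q}\lambda_j$ and $\mathsf{p}\mathsf{q}\lambda_j\cdot\sigma$ for $j\in I$, $\sigma\in\mathrm{Tr}(\mathsf{G}_j)$. $\mathrm{part}(\mathsf{G})=\bigcup_{\sigma\in\mathrm{Tr}(\mathsf{G})}\mathrm{part}(\sigma)$. For $\sigma\in \mathrm{Tr}(\mathsf{G})$, $\mathsf{G}_\sigma$ denotes the subterm of $\mathsf{G}$ reached after $\sigma$; subtrees of $\mathsf{G}$ are the $\mathsf{G}_\sigma$ (and $\mathsf{G}$ itself). Projection $\mathsf{G}\upharpoonright\mathsf{r}$ (partial, defined coinductively): $\mathsf{G}\upharpoonright\mathsf{r}=\mathbf{0}$ if $\mathsf{r}\notin\mathrm{part}(\mathsf{G})$; otherwise for $\mathsf{G}=\mathsf{p}\to\mathsf{q}:\{\lambda_i;\mathsf{G}_i\}_{i\in I}$: it is $\mathsf{p}?\{\lambda_i.\mathsf{G}_i\upharpoonright\mathsf{r}\}_{i\in I}$ if $\mathsf{r}=\mathsf{q}$; $\mathsf{q}!\{\lambda_i.\mathsf{G}_i\upharpoonright\mathsf{r}\}_{i\in I}$ if $\mathsf{r}=\mathsf{p}$; and $\mathsf{G}_1\upharpoonright\mathsf{r}$ if $\mathsf{r}\notin\{\mathsf{p},\mathsf{q}\}$, $\mathsf{r}\in\mathrm{part}(\mathsf{G}_1)$ and $\mathsf{G}_i\upharpoonright\mathsf{r}=\mathsf{G}_1\upharpoonright\mathsf{r}$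 for all $i\in I$ (undefined otherwise). $\mathsf{G}$ is projectable if $\mathsf{G}\upharpoonright\mathsf{p}$ is defined for all $\mathsf{p}$. Depth: for a trace $\sigma$, $\mathrm{depth}(\mathsf{p},\sigma)=|\sigma_1\cdot\alpha|$ if $\sigma=\sigma_1\cdot\alpha\cdot\sigma_2$ with $\mathsf{p}\notin\mathrm{part}(\sigma_1)$ and $\mathsf{p}\in\mathrm{part}(\alpha)$, and $0$ otherwise; $\mathrm{depth}(\mathsf{p},\mathsf{G})=\sup\{\mathrm{depth}(\mathsf{p},\sigma)\mid\sigma\in\mathrm{Tr}(\mathsf{G})\}$. $\mathsf{G}$ is bounded if $\mathrm{depth}(\mathsf{p},\mathsf{G}')$ is finite for every participant $\mathsf{p}$ and every subtree $\mathsf{G}'$ of $\mathsf{G}$. $\mathsf{G}$ is well formed if it is projectable and bounded. Process preorder $\le$ (rules interpreted coinductively): $\mathbf{0}\le\mathbf{0}$; $\mathsf{p}?\{\lambda_i.P_i\}_{i\in I\cup J}\le \mathsf{p}?\{\lambda_i.Q_i\}_{i\in I}$ if $P_i\le Q_i$ for all $i\in I$; $\mathsf{p}!\{\lambda_i.P_i\}_{i\in I}\le \mathsf{p}!\{\lambda_i.Q_i\}_{i\in I}$ if $P_i\le Q_i$ for all $i\in I$. Typing: $\vdash \prod_{i\in I}\mathsf{p}_i[P_i]:\mathsf{G}$ iff $P_i\le \mathsf{G}\upharpoonright\mathsf{p}_i$ for all $i\in I$ and $\mathrm{part}(\mathsf{G})\subseteq\{\mathsf{p}_i\mid i\in I\}$.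 Event structure of a global type: permutation equivalence $\sim$ on traces is the least equivalence with $\sigma\cdot\alpha\cdot\alpha'\cdot\sigma'\sim\sigma\cdot\alpha'\cdot\alpha\cdot\sigma'$ whenever $\mathrm{part}(\alpha)\cap\mathrm{part}(\alpha')=\emptyset$; $[\sigma]$ is the class of $\sigma$. A non-empty trace $\sigma=\sigma[1]\cdots\sigma[n]$ is pointed if for every $1\le i<n$ there is $j$ with $i<j\le n$ and $\mathrm{part}(\sigma[i])\cap\mathrm{part}(\sigma[j])\neq\emptyset$. A g-event is $[\sigma]$ with $\sigma$ pointed. Causal prefixing: $\alpha\circ[\sigma]=[\alpha\cdot\sigma]$ if $\mathrm{part}(\alpha)\cap\mathrm{part}(\sigma)\ne\emptyset$, and $=[\sigma]$ otherwise; $\epsilon\circ\gamma=\gamma$, $(\alpha\cdot\sigma)\circ\gamma=\alpha\circ(\sigma\circ\gamma)$. For a nonempty trace, $\mathrm{ev}(\sigma\cdot\alpha)=\sigma\circ[\alpha]$. On g-events: $\gamma\le\gamma'$ iff $\gamma=[\sigma]$, $\gamma'=[\sigma\cdot\sigma']$ for some $\sigma,\sigma'$; $\gamma\#\gamma'$ iff $\gamma=[\sigma\cdot\mathsf{p}\mathsf{q}\lambda_1\cdot\sigma_1]$, $\gamma'=[\sigma\cdot\mathsf{p}\mathsf{q}\lambda_2\cdot\sigma_2]$ with $\lambda_1\ne\lambda_2$. $\mathcal{S}(\mathsf{G})=(\mathcal{E}(\mathsf{G}),\le_{\mathsf{G}},\#_{\mathsf{G}})$ where $\mathcal{E}(\mathsf{G})=\{\mathrm{ev}(\sigma)\mid\sigma\in\mathrm{Tr}(\mathsf{G})\}$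 and $\le_{\mathsf{G}},\#_{\mathsf{G}}$ are the restrictions of $\le,\#$ to $\mathcal{E}(\mathsf{G})$. -}

module Defs where

open import Data.Nat using (ℕ; _≤_; zero; suc)
open import Data.Nat.Properties using (_≟_)
open import Data.Bool using (Bool; true; false; _∨_; if_then_else_)
open import Data.Product using (Σ; ∃; ∃-syntax; _×_; _,_; proj₁; proj₂)
open import Data.Sum using (_⊎_)
open import Data.Empty using (⊥)
open import Data.List using (List; []; _∷_; _++_; [_]; map)
open import Data.Bool.ListAction using (any)
open import Data.List.NonEmpty using (List⁺; toList) renaming (head to head⁺)
open import Data.List.Membership.Propositional using (_∈_)
open import Data.List.Relation.Unary.Any using (Any)
open import Data.List.Relation.Unary.All using (All)
open import Data.List.Relation.Unary.Unique.Propositional using (Unique)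
open import Relation.Binary.PropositionalEquality using (_≡_; _≢_)
open import Relation.Nullary using (¬_; does)

Part : Set
Part = ℕ

Label : Set
Label = ℕ

labels : {A : Set} → List⁺ (Label × A) → List Label
labels bs = map proj₁ (toList bs)

SameLabels : {A B : Set} → List⁺ (Label × A) → List⁺ (Label × B) → Set
SameLabels bs cs = (∀ l → l ∈ labels bs → l ∈ labels cs) × (∀ l → l ∈ labels cs → l ∈ labels bs)

mutual
  data PNode : Set where
    send : Part → (bs : List⁺ (Label × Proc)) → Unique (labels bs) → PNode
    recv : Part → (bs : List⁺ (Label × Proc)) → Unique (labels bs) → PNode
    nil  : PNode

  record Proc : Set where
    coinductive
    field pnode : PNode
open Proc public

-- equality of (possibly infinite) process terms: bisimilarity
mutual
  record _≅P_ (P Q : Proc) : Set where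
    coinductive
    field unfold≅P : Step≅P (pnode P) (pnode Q)

  data Step≅P : PNode → PNode → Set where
    nil≅  : Step≅P nil nil
    send≅ : ∀ {p bs ub cs uc} → SameLabels bs cs →
            (∀ l P Q → (l , P) ∈ toList bs → (l , Q) ∈ toList cs → P ≅P Q) →
            Step≅P (send p bs ub) (send p cs uc)
    recv≅ : ∀ {p bs ub cs uc} → SameLabels bs cs →
            (∀ l P Q → (l , P) ∈ toList bs → (l , Q) ∈ toList cs → P ≅P Q) →
            Step≅P (recv p bs ub) (recv p cs uc)

data PSub : Proc → Proc → Set where
  psub-refl : ∀ {P} → PSub P P
  psub-send : ∀ {P p bs u l P' Q} → pnode P ≡ send p bs u → (l , P') ∈ toList bs →
              PSub P' Q → PSub P Q
  psub-recv : ∀ {P p bs u l P' Q} → pnode P ≡ recv p bs u → (l , P') ∈ toList bs →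
              PSub P' Q → PSub P Q

RegularP : Proc → Set
RegularP P = ∃[ L ] (∀ Q → PSub P Q → Any (Q ≅P_) L)

mutual
  record _≼_ (P Q : Proc) : Set where
    coinductive
    field unfold≼ : Step≼ (pnode P) (pnode Q)

  data Step≼ : PNode → PNode → Set where
    nil≼  : Step≼ nil nil
    recv≼ : ∀ {p bs ub cs uc} → (∀ l → l ∈ labels cs → l ∈ labels bs) →
            (∀ l P Q → (l , P) ∈ toList bs → (l , Q) ∈ toList cs → P ≼ Q) →
            Step≼ (recv p bs ub) (recv p cs uc)
    send≼ : ∀ {p bs ub cs uc} → SameLabels bs cs →
            (∀ l P Q → (l , P) ∈ toList bs → (l , Q) ∈ toList cs → P ≼ Q) →
            Step≼ (send p bs ub) (send p cs uc)

mutual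
  data GNode : Set where
    gend  : GNode
    gcomm : (p q : Part) → p ≢ q → (bs : List⁺ (Label × Global)) → Unique (labels bs) → GNode

  record Global : Set where
    coinductive
    field gnode : GNode
open Global public

-- bisimilarity of global types (equality of infinite terms)
mutual
  record _≅G_ (G H : Global) : Set where
    coinductive
    field unfold≅G : Step≅G (gnode G) (gnode H)

  data Step≅G : GNode → GNode → Set where
    end≅  : Step≅G gend gend
    comm≅ : ∀ {p q pq pq' bs u cs u'} → SameLabels bs cs →
            (∀ l G H → (l , G) ∈ toList bs → (l , H) ∈ toList cs → G ≅G H) →
            Step≅G (gcomm p q pq bs u) (gcomm p q pq' cs u')

Comm : Set
Comm = Part × Part × Label

Trace : Set
Trace = List Comm

InC : Part → Comm → Set
InC r (p , q , _) = r ≡ p ⊎ r ≡ q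

InPartT : Part → Trace → Set
InPartT r σ = Any (InC r) σ

data TrN : GNode → Trace → Set where
  tr-one  : ∀ {p q pq bs u l G} → (l , G) ∈ toList bs →
            TrN (gcomm p q pq bs u) [ (p , q , l) ]
  tr-cons : ∀ {p q pq bs u l G σ} → (l , G) ∈ toList bs → TrN (gnode G) σ →
            TrN (gcomm p q pq bs u) ((p , q , l) ∷ σ)

Tr : Global → Trace → Set
Tr G = TrN (gnode G)

InPartN : Part → GNode → Set
InPartN r g = ∃[ σ ] (TrN g σ × InPartT r σ)

InPart : Part → Global → Set
InPart r G = InPartN r (gnode G)

data Sub : Global → Trace → Global → Set where
  sub-nil  : ∀ {G} → Sub G [] G
  sub-cons : ∀ {G p q pq bs u l G' σ H} → gnode G ≡ gcomm p q pq bs u →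
             (l , G') ∈ toList bs → Sub G' σ H → Sub G ((p , q , l) ∷ σ) H

RegularG : Global → Set
RegularG G = ∃[ L ] (∀ σ H → Sub G σ H → Any (H ≅G_) L)

mutual
  record Proj (G : Global) (r : Part) (P : Proc) : Set where
    coinductive
    field unfoldProj : ProjStep (gnode G) r P (pnode P)

  data ProjStep : GNode → Part → Proc → PNode → Set where
    pj-zero : ∀ {g r P} → ¬ InPartN r g → ProjStep g r P nil
    pj-recv : ∀ {p r pr bs u P cs uc} → SameLabels bs cs →
              (∀ l G Q → (l , G) ∈ toList bs → (l , Q) ∈ toList cs → Proj G r Q) →
              ProjStep (gcomm p r pr bs u) r P (recv p cs uc)
    pj-send : ∀ {r q pr bs u P cs uc} → SameLabels bs cs →
              (∀ l G Q → (l , G) ∈ toList bs → (l , Q) ∈ toList cs → Proj G r Q) →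
              ProjStep (gcomm r q pr bs u) r P (send q cs uc)
    pj-skip : ∀ {p q pq bs u r P pn} → r ≢ p → r ≢ q →
              InPart r (proj₂ (head⁺ bs)) →
              (∀ l G → (l , G) ∈ toList bs → Proj G r P) →
              ProjStep (gcomm p q pq bs u) r P pn

Projectable : Global → Set
Projectable G = ∀ p → ∃[ P ] Proj G p P

inC? : Part → Comm → Bool
inC? r (p , q , _) = does (r ≟ p) ∨ does (r ≟ q)

-- depth(p, σ): position (1-based) of the first communication involving p, 0 if none
depth : Part → Trace → ℕ
depth r [] = 0
depth r (α ∷ σ) with inC? r α | depth r σ
... | true  | _     = 1
... | false | zero  = zero
... | false | suc n = suc (suc n)

Bounded : Global → Set
Bounded G = ∀ σ H → Sub G σ H → ∀ p → ∃[ n ] (∀ τ → Tr H τ → depth p τ ≤ n)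

WellFormed : Global → Set
WellFormed G = Projectable G × Bounded G

Network : Set
Network = List (Part × Proc)

data NonEmpty {A : Set} : List A → Set where
  nonEmpty : ∀ {x xs} → NonEmpty (x ∷ xs)

ValidNetwork : Network → Set
ValidNetwork N = NonEmpty N × Unique (map proj₁ N) × All (λ pP → RegularP (proj₂ pP)) N

Typed : Network → Global → Set
Typed N G = (∀ p P → (p , P) ∈ N → ∃[ Q ] (Proj G p Q × P ≼ Q))
          × (∀ r → InPart r G → r ∈ map proj₁ N)

-- Event structure of a global type.  Equivalence classes [σ] are
-- represented by traces; equality of classes is ∼.

Disjoint : Comm → Comm → Set
Disjoint α β = ∀ r → InC r α → InC r β → ⊥

data _∼_ : Trace → Trace → Set where
  ∼-refl  : ∀ {σ} → σ ∼ σ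
  ∼-sym   : ∀ {σ τ} → σ ∼ τ → τ ∼ σ
  ∼-trans : ∀ {σ τ ρ} → σ ∼ τ → τ ∼ ρ → σ ∼ ρ
  ∼-swap  : ∀ σ α β σ' → Disjoint α β → (σ ++ α ∷ β ∷ σ') ∼ (σ ++ β ∷ α ∷ σ')

shareC : Comm → Comm → Bool
shareC (p , q , _) β = inC? p β ∨ inC? q β

meets : Comm → Trace → Bool
meets α σ = any (shareC α) σ

-- causal prefixing on representatives: α ∘ [σ]
_∘₁_ : Comm → Trace → Trace
α ∘₁ σ = if meets α σ then α ∷ σ else σ

_∘T_ : Trace → Trace → Trace
[] ∘T τ = τ
(α ∷ σ) ∘T τ = α ∘₁ (σ ∘T τ)

ev : Trace → Comm → Trace
ev σ α = σ ∘T [ α ]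

-- pointed traces (g-events are classes of pointed traces)
Pointed : Trace → Set
Pointed σ = NonEmpty σ × (∀ σ₁ α σ₂ → σ ≡ σ₁ ++ α ∷ σ₂ → NonEmpty σ₂ →
             ∃[ σ₃ ] ∃[ β ] ∃[ σ₄ ] (σ₂ ≡ σ₃ ++ β ∷ σ₄ × ¬ Disjoint α β))

InE : Global → Trace → Set
InE G τ = ∃[ σ ] ∃[ α ] (Tr G (σ ++ [ α ]) × τ ∼ ev σ α)

_≤E_ : Trace → Trace → Set
τ ≤E τ' = ∃[ σ ] ∃[ σ' ] (τ ∼ σ × τ' ∼ (σ ++ σ'))

_#E_ : Trace → Trace → Set
τ #E τ' = ∃[ σ ] ∃[ p ] ∃[ q ] ∃[ l₁ ] ∃[ l₂ ] ∃[ σ₁ ] ∃[ σ₂ ]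
          (l₁ ≢ l₂ × τ ∼ (σ ++ (p , q , l₁) ∷ σ₁) × τ' ∼ (σ ++ (p , q , l₂) ∷ σ₂))

_⟺_ : Set → Set → Set
A ⟺ B = (A → B) × (B → A)

SameES : Global → Global → Set
SameES G G' =
    (∀ τ → InE G τ ⟺ InE G' τ)
  × (∀ τ τ' → (InE G τ × InE G τ' × τ ≤E τ') ⟺ (InE G' τ × InE G' τ' × τ ≤E τ'))
  × (∀ τ τ' → (InE G τ × InE G τ' × τ #E τ') ⟺ (InE G' τ × InE G' τ' × τ #E τ'))

{-# OPTIONS --safe #-}
-- Read the processes of the network as a state S; it is typed by both G and G'.  By subject
-- reduction every trace σ·α of G is a run of S.  Conversely, whenever a state S typed by a
-- bounded G runs ρ·α, ev ρ α is an event of G.  This goes by induction on the length of ρ and on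
-- the depth in G of the sender of α, looking at the first communication p → q of G:
--   * if p acts in ρ, its first action there is p → q (q waits for p, so neither acts before
--     it), hence it commutes to the front of ρ without changing the event;
--   * if p first acts in α, then α is p → q and the event is [α];
--   * otherwise neither p nor q acts at all: the state after firing p → q along the first branch
--     runs ρ·α as well, is typed by that branch, where the sender of α is shallower, and the
--     event is not causally affected by p → q.
-- So ℰ(G) = ℰ(G'); causality and conflict are restrictions of relations independent of the
-- global type.

module Submission where

open import Defs
open import Data.Bool using (true; false; _∨_)
open import Data.Bool.Properties using (∨-assoc; ∨-comm; ∨-zeroʳ)
open import Data.Empty using (⊥-elim)
open import Data.List using ([]; _∷_; _++_; [_]; length)
import Data.List as List
open import Data.List.Properties using (++-assoc; length-++-sucʳ)
open import Data.List.Relation.Unary.All using (All; []; _∷_)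
open import Data.List.Relation.Unary.All.Properties using (++⁻ˡ; ++⁻ʳ)
import Data.List.Relation.Unary.All.Properties as All
open import Data.List.Relation.Unary.Any using (here; there)
import Data.List.Relation.Unary.Any.Properties as Any
open import Data.List.Relation.Unary.First using (first; FirstView)
import Data.List.Relation.Unary.First as First
open import Data.List.Relation.Unary.First.Properties using (toView)
open import Data.List.NonEmpty using (List⁺; toList)
open import Data.List.Membership.Propositional using (_∈_)
open import Data.List.Membership.Propositional.Properties using (∈-map⁺; ∈-map⁻)
open import Data.Product using (∃-syntax; _×_; _,_; proj₁; proj₂)
open import Data.Sum using (_⊎_; inj₁; inj₂)
import Data.Sum as Sum
open import Function using (_∘_)
open import Relation.Binary.Bundles using (Setoid)
open import Relation.Binary.Structures using (IsEquivalence)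
open import Relation.Binary.PropositionalEquality
  using (_≡_; _≢_; _≗_; ≢-sym; refl; sym; trans; cong; subst; module ≡-Reasoning)
open import Relation.Nullary using (¬_; Dec; yes; no)
open import Relation.Nullary.Decidable using (_⊎-dec_; dec-true; dec-false; toSum)
open import Relation.Nullary.Negation using (contradiction)
open import Data.Nat using (ℕ; zero; suc; _≤_; _<_; z≤n; s≤s; s≤s⁻¹)
open import Data.Nat.Properties using (_≟_; ≤-refl; ≤-trans)
import Relation.Binary.Reasoning.Setoid as SetoidReasoning

State : Set
State = Part → Proc

private
  variable
    p q r s : Part
    l : Label
    α β γ : Comm
    σ τ τ' ρ ρ' : Trace
    g : GNode
    G Gₗ : Global
    S S' : State
    P Q P' Q' : Proc
    ps qs : List⁺ (Label × Proc)
    pq : p ≢ q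
    bs : List⁺ (Label × Global)

InC? : ∀ r γ → Dec (InC r γ)
InC? r (p , q , _) = r ≟ p ⊎-dec r ≟ q

inC?-true : ∀ γ → InC r γ → inC? r γ ≡ true
inC?-true {r} (p , q , _) (inj₁ r≡p) rewrite dec-true (r ≟ p) r≡p = refl
inC?-true {r} (p , q , _) (inj₂ r≡q) rewrite dec-true (r ≟ q) r≡q = ∨-zeroʳ _

inC?-false : ∀ γ → ¬ InC r γ → inC? r γ ≡ false
inC?-false {r} (p , q , _) r∉γ
  rewrite dec-false (r ≟ p) (r∉γ ∘ inj₁) | dec-false (r ≟ q) (r∉γ ∘ inj₂) = refl

Disjoint-sym : ∀ α β → Disjoint α β → Disjoint β α
Disjoint-sym _ _ d r r∈β r∈α = d r r∈α r∈β

shareC-false : ∀ α β → Disjoint α β → shareC α β ≡ false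
shareC-false (p , q , _) β d
  rewrite inC?-false β (d p (inj₁ refl)) | inC?-false β (d q (inj₂ refl)) = refl

meets-false : All (Disjoint α) σ → meets α σ ≡ false
meets-false [] = refl
meets-false {α} {β ∷ _} (d ∷ ds) rewrite shareC-false α β d = meets-false {α} ds

Absent : Part → Trace → Set
Absent p = All (¬_ ∘ InC p)

Absent⇒Disjoint : Absent p σ → Absent q σ → All (Disjoint (p , q , l)) σ
Absent⇒Disjoint [] [] = []
Absent⇒Disjoint {p = p} {σ = γ ∷ _} {q = q} {l = l} (p∉γ ∷ p∉σ) (q∉γ ∷ q∉σ) =
  disjoint ∷ Absent⇒Disjoint {l = l} p∉σ q∉σ
  where
    disjoint : Disjoint (p , q , l) γ
    disjoint r (inj₁ refl) r∈γ = p∉γ r∈γ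
    disjoint r (inj₂ refl) r∈γ = q∉γ r∈γ

∼-isEquivalence : IsEquivalence _∼_
∼-isEquivalence = record { refl = ∼-refl ; sym = ∼-sym ; trans = ∼-trans }

∼-setoid : Setoid _ _
∼-setoid = record { isEquivalence = ∼-isEquivalence }

∼-cons : ∀ α → σ ∼ τ → (α ∷ σ) ∼ (α ∷ τ)
∼-cons α ∼-refl = ∼-refl
∼-cons α (∼-sym e) = ∼-sym (∼-cons α e)
∼-cons α (∼-trans e e') = ∼-trans (∼-cons α e) (∼-cons α e')
∼-cons α (∼-swap σ β γ σ' d) = ∼-swap (α ∷ σ) β γ σ' d

meets-swap : ∀ α σ β γ σ' → meets α (σ ++ β ∷ γ ∷ σ') ≡ meets α (σ ++ γ ∷ β ∷ σ')
meets-swap α [] β γ σ' =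
  trans (sym (∨-assoc (shareC α β) (shareC α γ) _))
    (trans (cong (_∨ meets α σ') (∨-comm (shareC α β) (shareC α γ)))
      (∨-assoc (shareC α γ) (shareC α β) _))
meets-swap α (δ ∷ σ) β γ σ' = cong (shareC α δ ∨_) (meets-swap α σ β γ σ')

meets-resp-∼ : ∀ α → σ ∼ τ → meets α σ ≡ meets α τ
meets-resp-∼ α ∼-refl = refl
meets-resp-∼ α (∼-sym e) = sym (meets-resp-∼ α e)
meets-resp-∼ α (∼-trans e e') = trans (meets-resp-∼ α e) (meets-resp-∼ α e')
meets-resp-∼ α (∼-swap σ β γ σ' _) = meets-swap α σ β γ σ'

∘₁-resp-∼ : ∀ α → σ ∼ τ → (α ∘₁ σ) ∼ (α ∘₁ τ)
∘₁-resp-∼ {σ} {τ} α σ∼τ with meets α σ | meets α τ | meets-resp-∼ α σ∼τ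
... | true  | .true  | refl = ∼-cons α σ∼τ
... | false | .false | refl = σ∼τ

∘₁-comm : ∀ α β σ → Disjoint α β → (α ∘₁ (β ∘₁ σ)) ∼ (β ∘₁ (α ∘₁ σ))
∘₁-comm α β σ d with meets β σ in βσ | meets α σ in ασ
... | true  | true
  rewrite shareC-false α β d | ασ | shareC-false β α (Disjoint-sym α β d) | βσ = ∼-swap [] α β σ d
... | true  | false rewrite shareC-false α β d | ασ | βσ = ∼-refl
... | false | true  rewrite ασ | shareC-false β α (Disjoint-sym α β d) | βσ = ∼-refl
... | false | false rewrite ασ | βσ = ∼-refl

∘₁-false : ∀ α σ → meets α σ ≡ false → α ∘₁ σ ≡ σ
∘₁-false _ _ e rewrite e = refl

∘T-++ : ∀ ρ ρ' τ → (ρ ++ ρ') ∘T τ ≡ ρ ∘T (ρ' ∘T τ)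
∘T-++ [] ρ' τ = refl
∘T-++ (γ ∷ ρ) ρ' τ = cong (γ ∘₁_) (∘T-++ ρ ρ' τ)

∘T-comm : All (Disjoint β) ρ → (ρ ∘T (β ∘₁ τ)) ∼ (β ∘₁ (ρ ∘T τ))
∘T-comm [] = ∼-refl
∘T-comm {β} {γ ∷ ρ} {τ} (d ∷ ds) =
  ∼-trans (∘₁-resp-∼ γ (∘T-comm ds)) (∘₁-comm γ β (ρ ∘T τ) (Disjoint-sym β γ d))

∘T-All : ∀ {P : Comm → Set} ρ → All P ρ → All P τ → All P (ρ ∘T τ)
∘T-All [] [] Pτ = Pτ
∘T-All {τ} (γ ∷ ρ) (Pγ ∷ Pρ) Pτ with meets γ (ρ ∘T τ)
... | true  = Pγ ∷ ∘T-All ρ Pρ Pτ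
... | false = ∘T-All ρ Pρ Pτ

ev-++-∼ : ∀ ρ → All (Disjoint β) ρ → ev (ρ ++ β ∷ ρ') α ∼ (β ∘₁ ev (ρ ++ ρ') α)
ev-++-∼ {β} {ρ'} {α} ρ d = begin
  ev (ρ ++ β ∷ ρ') α          ≡⟨ ∘T-++ ρ (β ∷ ρ') [ α ] ⟩
  ρ ∘T (β ∘₁ (ρ' ∘T [ α ]))  ≈⟨ ∘T-comm d ⟩
  β ∘₁ (ρ ∘T (ρ' ∘T [ α ]))  ≡⟨ cong (β ∘₁_) (∘T-++ ρ ρ' [ α ]) ⟨
  β ∘₁ ev (ρ ++ ρ') α        ∎
  where open SetoidReasoning ∼-setoid

ev-Disjoint : All (Disjoint α) ρ → ev ρ α ≡ [ α ]
ev-Disjoint [] = refl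
ev-Disjoint {α} {γ ∷ ρ} (d ∷ ds) = begin
  γ ∘₁ ev ρ α  ≡⟨ cong (γ ∘₁_) (ev-Disjoint ds) ⟩
  γ ∘₁ [ α ]   ≡⟨ ∘₁-false γ [ α ] (meets-false {γ} {[ α ]} (Disjoint-sym α γ d ∷ [])) ⟩
  [ α ]        ∎
  where open ≡-Reasoning

∘₁-absorb : All (Disjoint β) (ρ ++ [ α ]) → (β ∘₁ ev ρ α) ≡ ev ρ α
∘₁-absorb {β} {ρ} {α} d = ∘₁-false β (ev ρ α) (meets-false {β} (∘T-All ρ (++⁻ˡ ρ d) (++⁻ʳ ρ d)))

InE-resp-∼ : τ ∼ τ' → InE G τ' → InE G τ
InE-resp-∼ τ∼τ' (σ , α , t , τ'∼) = σ , α , t , ∼-trans τ∼τ' τ'∼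

Tr-branch : ∀ {u} → gnode G ≡ gcomm p q pq bs u → (l , Gₗ) ∈ toList bs → Tr Gₗ σ →
            Tr G ((p , q , l) ∷ σ)
Tr-branch G≡ Gₗ∈ t = subst (λ g → TrN g _) (sym G≡) (tr-cons Gₗ∈ t)

InE-branch : ∀ {u} → gnode G ≡ gcomm p q pq bs u → (l , Gₗ) ∈ toList bs → InE Gₗ τ →
             InE G ((p , q , l) ∘₁ τ)
InE-branch {G = G} {p = p} {q} {l = l} {Gₗ = Gₗ} G≡ Gₗ∈ (σ , α , t , τ∼) =
  (p , q , l) ∷ σ , α , Tr-branch {G = G} {Gₗ = Gₗ} G≡ Gₗ∈ t , ∘₁-resp-∼ (p , q , l) τ∼

InE-head : ∀ {u} → gnode G ≡ gcomm p q pq bs u → (l , Gₗ) ∈ toList bs → InE G [ (p , q , l) ]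
InE-head G≡ Gₗ∈ = [] , _ , subst (λ g → TrN g _) (sym G≡) (tr-one Gₗ∈) , ∼-refl

infixl 6 _[_≔_]

_[_≔_] : State → Part → Proc → State
(S [ p ≔ P ]) r with r ≟ p
... | yes _ = P
... | no  _ = S r

≔-same : ∀ S p P → (S [ p ≔ P ]) p ≡ P
≔-same S p P with p ≟ p
... | yes _   = refl
... | no  p≢p = ⊥-elim (p≢p refl)

≔-other : r ≢ p → (S [ p ≔ P ]) r ≡ S r
≔-other {r} {p} r≢p with r ≟ p
... | yes r≡p = ⊥-elim (r≢p r≡p)
... | no  _   = refl

≔-other₂ : r ≢ p → r ≢ q → (S [ p ≔ P ] [ q ≔ Q ]) r ≡ S r
≔-other₂ r≢p r≢q = trans (≔-other r≢q) (≔-other r≢p)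

≔-cong : S ≗ S' → S [ p ≔ P ] ≗ S' [ p ≔ P ]
≔-cong {p = p} S≗S' r with r ≟ p
... | yes _ = refl
... | no  _ = S≗S' r

≔-comm : p ≢ q → S [ p ≔ P ] [ q ≔ Q ] ≗ S [ q ≔ Q ] [ p ≔ P ]
≔-comm {p} {q} {S} {P} {Q} p≢q r = by-cases (r ≟ p) (r ≟ q)
  where
    by-cases : Dec (r ≡ p) → Dec (r ≡ q) →
               (S [ p ≔ P ] [ q ≔ Q ]) r ≡ (S [ q ≔ Q ] [ p ≔ P ]) r
    by-cases (yes refl) (yes r≡q) = ⊥-elim (p≢q r≡q)
    by-cases (yes refl) (no  r≢q) =
      trans (≔-other r≢q) (trans (≔-same S p P) (sym (≔-same (S [ q ≔ Q ]) p P)))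
    by-cases (no  r≢p) (yes refl) =
      trans (≔-same (S [ p ≔ P ]) q Q) (sym (trans (≔-other r≢p) (≔-same S q Q)))
    by-cases (no  r≢p) (no  r≢q) = trans (≔-other₂ r≢p r≢q) (sym (≔-other₂ r≢q r≢p))

≔-comm₂ : p ≢ r → p ≢ s → q ≢ r → q ≢ s →
          S [ p ≔ P ] [ q ≔ Q ] [ r ≔ P' ] [ s ≔ Q' ] ≗ S [ r ≔ P' ] [ s ≔ Q' ] [ p ≔ P ] [ q ≔ Q ]
≔-comm₂ p≢r p≢s q≢r q≢s x =
  trans (≔-cong (≔-comm q≢r) x)
  (trans (≔-comm q≢s x)
  (trans (≔-cong (≔-cong (≔-comm p≢r)) x)
         (≔-cong (≔-comm p≢s) x)))

data Run : State → Trace → Set where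
  []   : Run S []
  step : ∀ {ups uqs} → pnode (S p) ≡ send q ps ups → (l , P) ∈ toList ps →
         pnode (S q) ≡ recv p qs uqs → (l , Q) ∈ toList qs →
         Run (S [ p ≔ P ] [ q ≔ Q ]) ρ → Run S ((p , q , l) ∷ ρ)

send≢nil : ∀ {u} → send q ps u ≢ nil
send≢nil ()

recv≢nil : ∀ {u} → recv q ps u ≢ nil
recv≢nil ()

send≢recv : ∀ {u v} → send q ps u ≢ recv p qs v
send≢recv ()

recv-injective : ∀ {u v} → recv p ps u ≡ recv q qs v → p ≡ q
recv-injective refl = refl

Run-cong : S ≗ S' → Run S ρ → Run S' ρ
Run-cong S≗S' [] = []
Run-cong S≗S' (step {p = p} {q = q} Sp Pₗ Sq Qₗ run) =
  step (trans (cong pnode (sym (S≗S' p))) Sp) Pₗ (trans (cong pnode (sym (S≗S' q))) Sq) Qₗ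
       (Run-cong (≔-cong (≔-cong S≗S')) run)

step-framed : ∀ {x y ux uy X Y} → ¬ InC p (x , y , l) → ¬ InC q (x , y , l) →
              pnode (S x) ≡ send y ps ux → (l , X) ∈ toList ps →
              pnode (S y) ≡ recv x qs uy → (l , Y) ∈ toList qs →
              Run (S [ x ≔ X ] [ y ≔ Y ] [ p ≔ P ] [ q ≔ Q ]) ρ →
              Run (S [ p ≔ P ] [ q ≔ Q ]) ((x , y , l) ∷ ρ)
step-framed p∉γ q∉γ Sx Xₗ Sy Yₗ run =
  step (trans (cong pnode (≔-other₂ (≢-sym (p∉γ ∘ inj₁)) (≢-sym (q∉γ ∘ inj₁)))) Sx) Xₗ
       (trans (cong pnode (≔-other₂ (≢-sym (p∉γ ∘ inj₂)) (≢-sym (q∉γ ∘ inj₂)))) Sy) Yₗ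
       (Run-cong (≔-comm₂ (≢-sym (p∉γ ∘ inj₁)) (≢-sym (q∉γ ∘ inj₁))
                          (≢-sym (p∉γ ∘ inj₂)) (≢-sym (q∉γ ∘ inj₂))) run)

Run-frame : Absent p ρ → Absent q ρ → Run S ρ → Run (S [ p ≔ P ] [ q ≔ Q ]) ρ
Run-frame _ _ [] = []
Run-frame (p∉γ ∷ p∉ρ) (q∉γ ∷ q∉ρ) (step Sx Xₗ Sy Yₗ run) =
  step-framed p∉γ q∉γ Sx Xₗ Sy Yₗ (Run-frame p∉ρ q∉ρ run)

Run-prefix : ∀ ρ → Run S (ρ ++ ρ') → Run S ρ
Run-prefix [] _ = []
Run-prefix (_ ∷ ρ) (step Sp Pₗ Sq Qₗ run) = step Sp Pₗ Sq Qₗ (Run-prefix ρ run)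

Run-active : Run S ρ → InPartT s ρ → pnode (S s) ≢ nil
Run-active (step Sp _ _ _ _) (here (inj₁ refl)) = send≢nil ∘ trans (sym Sp)
Run-active (step _ _ Sq _ _) (here (inj₂ refl)) = recv≢nil ∘ trans (sym Sq)
Run-active {s = s} (step {p = p} {q = q} Sp _ Sq _ run) (there s∈ρ) with s ≟ p | s ≟ q
... | yes refl | _        = send≢nil ∘ trans (sym Sp)
... | no  _    | yes refl = recv≢nil ∘ trans (sym Sq)
... | no  s≢p  | no  s≢q  = Run-active run s∈ρ ∘ trans (cong pnode (≔-other₂ s≢p s≢q))

Run-receiver-waits : ∀ {v} → Run S ρ → Absent p ρ → pnode (S q) ≡ recv p qs v → Absent q ρ
Run-receiver-waits [] _ _ = []
Run-receiver-waits {p = p} {q = q}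
  (step {p = x} {q = y} {l = l} Sx _ Sy _ run) (p∉γ ∷ p∉ρ) Sq =
  q∉γ ∷ Run-receiver-waits run p∉ρ (trans (cong pnode (≔-other₂ (q∉γ ∘ inj₁) (q∉γ ∘ inj₂))) Sq)
  where
    q∉γ : ¬ InC q (x , y , l)
    q∉γ (inj₁ refl) = send≢recv (trans (sym Sx) Sq)
    q∉γ (inj₂ refl) = p∉γ (inj₁ (recv-injective (trans (sym Sq) Sy)))

Run-first-of-sender : ∀ ρ {β ups uqs} → Run S (ρ ++ β ∷ ρ') → Absent p ρ → Absent q ρ → InC p β →
  pnode (S p) ≡ send q ps ups → pnode (S q) ≡ recv p qs uqs →
  ∃[ l ] ∃[ P ] ∃[ Q ] (β ≡ (p , q , l) × (l , P) ∈ toList ps × (l , Q) ∈ toList qs ×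
                        Run (S [ p ≔ P ] [ q ≔ Q ]) (ρ ++ ρ'))
Run-first-of-sender [] (step Sx Pₗ Sy Qₗ run) [] [] (inj₁ refl) Sp Sq
  with refl ← trans (sym Sp) Sx with refl ← trans (sym Sq) Sy = _ , _ , _ , refl , Pₗ , Qₗ , run
Run-first-of-sender [] (step _ _ Sy _ _) [] [] (inj₂ refl) Sp _ =
  ⊥-elim (send≢recv (trans (sym Sp) Sy))
Run-first-of-sender (γ ∷ ρ) (step Sx Xₗ Sy Yₗ run) (p∉γ ∷ p∉ρ) (q∉γ ∷ q∉ρ) p∈β Sp Sq
  with Run-first-of-sender ρ run p∉ρ q∉ρ p∈β
         (trans (cong pnode (≔-other₂ (p∉γ ∘ inj₁) (p∉γ ∘ inj₂))) Sp)
         (trans (cong pnode (≔-other₂ (q∉γ ∘ inj₁) (q∉γ ∘ inj₂))) Sq)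
... | l , P , Q , β≡ , Pₗ , Qₗ , run' =
  l , P , Q , β≡ , Pₗ , Qₗ , step-framed p∉γ q∉γ Sx Xₗ Sy Yₗ run'

∈-labels⁺ : ∀ {A : Set} {X : A} {xs} → (l , X) ∈ toList xs → l ∈ labels xs
∈-labels⁺ = ∈-map⁺ proj₁

∈-labels⁻ : ∀ {A : Set} {xs : List⁺ (Label × A)} → l ∈ labels xs → ∃[ X ] ((l , X) ∈ toList xs)
∈-labels⁻ l∈ with ∈-map⁻ proj₁ l∈
... | (_ , X) , m , refl = X , m

infix 4 _≼_↾_

_≼_↾_ : Proc → GNode → Part → Set
P ≼ g ↾ r = ∃[ Q ] (ProjStep g r Q (pnode Q) × P ≼ Q)

TypedState : State → GNode → Set
TypedState S g = ∀ r → S r ≼ g ↾ r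

BranchesTyped : Part → List⁺ (Label × Global) → List⁺ (Label × Proc) → Set
BranchesTyped r bs ps = ∀ {l G P} → (l , G) ∈ toList bs → (l , P) ∈ toList ps → P ≼ gnode G ↾ r

Sends : Part → Part → List⁺ (Label × Global) → PNode → Set
Sends p q bs m = ∃[ ps ] ∃[ ups ] (m ≡ send q ps ups × SameLabels bs ps × BranchesTyped p bs ps)

Receives : Part → Part → List⁺ (Label × Global) → PNode → Set
Receives p q bs m =
  ∃[ qs ] ∃[ uqs ] (m ≡ recv p qs uqs × (∀ l → l ∈ labels bs → l ∈ labels qs) ×
                    BranchesTyped q bs qs)

branches-typed : ∀ {cs} → (∀ l G Q → (l , G) ∈ toList bs → (l , Q) ∈ toList cs → Proj G r Q) →
                 (∀ l P Q → (l , P) ∈ toList ps → (l , Q) ∈ toList cs → P ≼ Q) →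
                 (∀ l → l ∈ labels bs → l ∈ labels cs) → BranchesTyped r bs ps
branches-typed proj refines bs⊆cs Gₗ Pₗ with ∈-labels⁻ (bs⊆cs _ (∈-labels⁺ Gₗ))
... | Q , Qₗ = Q , Proj.unfoldProj (proj _ _ _ Gₗ Qₗ) , refines _ _ _ Pₗ Qₗ

sender-typing : ∀ {u} → P ≼ gcomm p q pq bs u ↾ p → Sends p q bs (pnode P)
sender-typing {p = p} {q} {pq} {bs} {u = u} (Q , pj , P≼Q) = go pj (_≼_.unfold≼ P≼Q)
  where
    go : ∀ {m n} → ProjStep (gcomm p q pq bs u) p Q n → Step≼ m n → Sends p q bs m
    go (pj-zero p∉G) _ = ⊥-elim (p∉G (_ , tr-one (here refl) , here (inj₁ refl)))
    go (pj-recv _ _) _ = ⊥-elim (pq refl)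
    go (pj-skip p≢p _ _ _) _ = ⊥-elim (p≢p refl)
    go (pj-send bs≈cs proj) (send≼ ps≈cs refines) =
      _ , _ , refl ,
      ((λ l → proj₂ ps≈cs l ∘ proj₁ bs≈cs l) , (λ l → proj₂ bs≈cs l ∘ proj₁ ps≈cs l)) ,
      branches-typed proj refines (proj₁ bs≈cs)

receiver-typing : ∀ {u} → Q ≼ gcomm p q pq bs u ↾ q → Receives p q bs (pnode Q)
receiver-typing {p = p} {q} {pq} {bs} {u = u} (Q' , pj , Q≼Q') = go pj (_≼_.unfold≼ Q≼Q')
  where
    go : ∀ {m n} → ProjStep (gcomm p q pq bs u) q Q' n → Step≼ m n → Receives p q bs m
    go (pj-zero q∉G) _ = ⊥-elim (q∉G (_ , tr-one (here refl) , here (inj₂ refl)))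
    go (pj-send _ _) _ = ⊥-elim (pq refl)
    go (pj-skip _ q≢q _ _) _ = ⊥-elim (q≢q refl)
    go (pj-recv bs≈cs proj) (recv≼ cs⊆qs refines) =
      _ , _ , refl , (λ l → cs⊆qs l ∘ proj₁ bs≈cs l) , branches-typed proj refines (proj₁ bs≈cs)

bystander-typing : ∀ {u} → r ≢ p → r ≢ q → P ≼ gcomm p q pq bs u ↾ r → (l , Gₗ) ∈ toList bs →
                   P ≼ gnode Gₗ ↾ r
bystander-typing {r} {p} {q} {pq = pq} {bs} {l = l} {Gₗ} {u = u} r≢p r≢q (Q , pj , P≼Q) Gₗ∈ =
  Q , go pj refl , P≼Q
  where
    go : ∀ {n} → ProjStep (gcomm p q pq bs u) r Q n → n ≡ pnode Q → ProjStep (gnode Gₗ) r Q n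
    go (pj-zero r∉G) _ = pj-zero λ (σ , t , r∈σ) → r∉G (_ , tr-cons Gₗ∈ t , there r∈σ)
    go (pj-recv _ _) _ = ⊥-elim (r≢q refl)
    go (pj-send _ _) _ = ⊥-elim (r≢p refl)
    go (pj-skip _ _ _ proj) n≡ = subst (ProjStep _ _ _) (sym n≡) (Proj.unfoldProj (proj _ _ Gₗ∈))

TypedState-step : ∀ {u} → TypedState S (gcomm p q pq bs u) →
  BranchesTyped p bs ps → BranchesTyped q bs qs →
  (l , Gₗ) ∈ toList bs → (l , P) ∈ toList ps → (l , Q) ∈ toList qs →
  TypedState (S [ p ≔ P ] [ q ≔ Q ]) (gnode Gₗ)
TypedState-step {S = S} {p} {q} {Gₗ = Gₗ} {P} {Q} ⊢S p-typed q-typed Gₗ∈ Pₗ Qₗ r =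
  by-cases (r ≟ q) (r ≟ p)
  where
    by-cases : Dec (r ≡ q) → Dec (r ≡ p) → (S [ p ≔ P ] [ q ≔ Q ]) r ≼ gnode Gₗ ↾ r
    by-cases (yes refl) _ =
      subst (_≼ gnode Gₗ ↾ r) (sym (≔-same (S [ p ≔ P ]) q Q)) (q-typed Gₗ∈ Qₗ)
    by-cases (no r≢q) (yes refl) =
      subst (_≼ gnode Gₗ ↾ r) (sym (trans (≔-other r≢q) (≔-same S p P))) (p-typed Gₗ∈ Pₗ)
    by-cases (no r≢q) (no r≢p) =
      subst (_≼ gnode Gₗ ↾ r) (sym (≔-other₂ r≢p r≢q)) (bystander-typing r≢p r≢q (⊢S r) Gₗ∈)

TypedState-fire : ∀ {u} → TypedState S (gcomm p q pq bs u) → (l , Gₗ) ∈ toList bs →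
  ∃[ P ] ∃[ Q ] ((∀ {ρ} → Run (S [ p ≔ P ] [ q ≔ Q ]) ρ → Run S ((p , q , l) ∷ ρ)) ×
                 TypedState (S [ p ≔ P ] [ q ≔ Q ]) (gnode Gₗ))
TypedState-fire {p = p} {q} ⊢S Gₗ∈ with sender-typing (⊢S p) | receiver-typing (⊢S q)
... | _ , _ , Sp , bs≈ps , p-typed | _ , _ , Sq , bs⊆qs , q-typed
  with ∈-labels⁻ (proj₁ bs≈ps _ (∈-labels⁺ Gₗ∈)) | ∈-labels⁻ (bs⊆qs _ (∈-labels⁺ Gₗ∈))
... | P , Pₗ | Q , Qₗ = P , Q , step Sp Pₗ Sq Qₗ , TypedState-step ⊢S p-typed q-typed Gₗ∈ Pₗ Qₗ

Run-of-trace : TypedState S g → TrN g ρ → Run S ρ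
Run-of-trace ⊢S (tr-one Gₗ∈) = let _ , _ , fire , _ = TypedState-fire ⊢S Gₗ∈ in fire []
Run-of-trace ⊢S (tr-cons Gₗ∈ t) =
  let _ , _ , fire , ⊢S' = TypedState-fire ⊢S Gₗ∈ in fire (Run-of-trace ⊢S' t)

TypedState-participant : TypedState S g → pnode (S s) ≢ nil → InPartN s g
TypedState-participant {s = s} ⊢S active with ⊢S s
... | Q , pj , S≼Q = go pj (_≼_.unfold≼ S≼Q) active
  where
    go : ∀ {g m n} → ProjStep g s Q n → Step≼ m n → m ≢ nil → InPartN s g
    go (pj-zero _) nil≼ m≢nil = ⊥-elim (m≢nil refl)
    go (pj-recv _ _) _ _ = _ , tr-one (here refl) , here (inj₂ refl)
    go (pj-send _ _) _ _ = _ , tr-one (here refl) , here (inj₁ refl)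
    go (pj-skip _ _ (σ , t , s∈σ) _) _ _ = _ , tr-cons (here refl) t , there s∈σ

depth-pos : InPartT s τ → 1 ≤ depth s τ
depth-pos {s} {α ∷ τ} (here s∈α) rewrite inC?-true α s∈α = s≤s z≤n
depth-pos {s} {α ∷ τ} (there s∈τ) with inC? s α | depth s τ | depth-pos s∈τ
... | true  | _     | _ = s≤s z≤n
... | false | suc _ | _ = s≤s z≤n

depth-tail : ∀ {n} → ¬ InC s β → depth s (β ∷ τ) ≤ suc n → depth s τ ≤ n
depth-tail {s} {β} {τ} s∉β le with inC? s β | inC?-false β s∉β | depth s τ | le
... | .false | refl | zero  | _        = z≤n
... | .false | refl | suc _ | s≤s le' = le'

End-no-participant : gnode G ≡ gend → ¬ InPart s G
End-no-participant G≡ (τ , t , _) with subst (λ g → TrN g τ) G≡ t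
... | ()

DepthBound : Part → Global → ℕ → Set
DepthBound s G n = ∀ τ → Tr G τ → depth s τ ≤ n

depth-bound : Bounded G → ∀ s → ∃[ n ] DepthBound s G n
depth-bound bd = bd [] _ sub-nil

Bounded-branch : ∀ {u} → Bounded G → gnode G ≡ gcomm p q pq bs u → (l , Gₗ) ∈ toList bs →
                 Bounded Gₗ
Bounded-branch bd G≡ Gₗ∈ σ H sub = bd (_ ∷ σ) H (sub-cons G≡ Gₗ∈ sub)

DepthBound-branch : ∀ {u n} → ¬ InC s (p , q , l) → gnode G ≡ gcomm p q pq bs u →
                    (l , Gₗ) ∈ toList bs → DepthBound s G (suc n) → DepthBound s Gₗ n
DepthBound-branch {p = p} {q} {l} {G = G} {Gₗ = Gₗ} s∉ G≡ Gₗ∈ db τ t =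
  depth-tail {β = p , q , l} {τ = τ} s∉ (db _ (Tr-branch {G = G} {Gₗ = Gₗ} G≡ Gₗ∈ t))

sender-participates : TypedState S (gnode G) → Run S (ρ ++ [ α ]) → InPart (proj₁ α) G
sender-participates {ρ = ρ} ⊢S run =
  TypedState-participant ⊢S (Run-active run (Any.++⁺ʳ ρ (here (inj₁ refl))))

EventsOfRuns : ℕ → ℕ → Set
EventsOfRuns k n = ∀ {G S ρ α} → length ρ < k → DepthBound (proj₁ α) G n → Bounded G →
                   TypedState S (gnode G) → Run S (ρ ++ [ α ]) → InE G (ev ρ α)

events-at-comm : ∀ {k n u} → (∀ n' → EventsOfRuns k n') → EventsOfRuns (suc k) n →
  gnode G ≡ gcomm p q pq bs u → TypedState S (gcomm p q pq bs u) →
  length ρ < suc k → DepthBound (proj₁ α) G (suc n) → Bounded G → Run S (ρ ++ [ α ]) →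
  InE G (ev ρ α)
events-at-comm {G = G} {p = p} {q = q} {bs = bs} {S = S} {ρ = ρ} {α = α} {k = k}
               shorter shallower G≡ ⊢S ρ<k db bd run
  with sender-typing (⊢S p) | receiver-typing (⊢S q)
... | _ , _ , Sp , bs≈ps , p-typed | _ , _ , Sq , bs⊆qs , q-typed =
  Sum.[ p-active ∘ toView , p-idle ]′ (first (λ γ → Sum.swap (toSum (InC? p γ))) ρ)
  where
    p-active : FirstView (¬_ ∘ InC p) (InC p) ρ → InE G (ev ρ α)
    p-active (First._++_∷_ {ρ₁} {β} p∉ρ₁ p∈β ρ₂)
      with run₁ ← subst (Run S) (++-assoc ρ₁ (β ∷ ρ₂) [ α ]) run
      with q∉ρ₁ ← Run-receiver-waits (Run-prefix ρ₁ run₁) p∉ρ₁ Sq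
      with l , P , Q , refl , Pₗ , Qₗ , run₂ ← Run-first-of-sender ρ₁ run₁ p∉ρ₁ q∉ρ₁ p∈β Sp Sq
      with Gₗ , Gₗ∈ ← ∈-labels⁻ (proj₂ bs≈ps l (∈-labels⁺ Pₗ))
      with bd' ← Bounded-branch {G = G} {Gₗ = Gₗ} bd G≡ Gₗ∈
      with n' , db' ← depth-bound {G = Gₗ} bd' (proj₁ α) =
      InE-resp-∼ {G = G} (ev-++-∼ ρ₁ (Absent⇒Disjoint {l = l} p∉ρ₁ q∉ρ₁))
        (InE-branch {G = G} {Gₗ = Gₗ} G≡ Gₗ∈
          (shorter n' {G = Gₗ} (s≤s⁻¹ (subst (_< suc k) (length-++-sucʳ ρ₁ β ρ₂) ρ<k)) db' bd'
             (TypedState-step ⊢S p-typed q-typed Gₗ∈ Pₗ Qₗ)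
             (subst (Run _) (sym (++-assoc ρ₁ ρ₂ [ α ])) run₂)))

    l₀ : Label
    l₀ = proj₁ (List⁺.head bs)

    sender-not-first : ¬ InC p α → Absent q (ρ ++ [ α ]) → ¬ InC (proj₁ α) (p , q , l)
    sender-not-first p∉α q∉ρα (inj₁ α≡p) = p∉α (inj₁ (sym α≡p))
    sender-not-first p∉α q∉ρα (inj₂ α≡q) with All.++⁻ʳ ρ q∉ρα
    ... | q∉α ∷ [] = q∉α (inj₁ (sym α≡q))

    p-idle : Absent p ρ → InE G (ev ρ α)
    p-idle p∉ρ with InC? p α
    ... | yes p∈α
      with q∉ρ ← Run-receiver-waits (Run-prefix ρ run) p∉ρ Sq
      with l , _ , _ , refl , Pₗ , _ , _ ← Run-first-of-sender ρ run p∉ρ q∉ρ p∈α Sp Sq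
      with Gₗ , Gₗ∈ ← ∈-labels⁻ (proj₂ bs≈ps l (∈-labels⁺ Pₗ)) =
      subst (InE G) (sym (ev-Disjoint (Absent⇒Disjoint {l = l} p∉ρ q∉ρ))) (InE-head {G = G} G≡ Gₗ∈)
    ... | no p∉α
      with p∉ρα ← All.++⁺ p∉ρ (p∉α ∷ [])
      with q∉ρα ← Run-receiver-waits run p∉ρα Sq
      with _ , _ , _ , ⊢S' ← TypedState-fire ⊢S (here refl) =
      subst (InE G) (∘₁-absorb (Absent⇒Disjoint {l = l₀} p∉ρα q∉ρα))
        (InE-branch {G = G} G≡ (here refl)
          (shallower ρ<k
             (DepthBound-branch {G = G} (sender-not-first {l = l₀} p∉α q∉ρα) G≡ (here refl) db)
             (Bounded-branch {G = G} bd G≡ (here refl)) ⊢S' (Run-frame p∉ρα q∉ρα run)))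

EventsOfRuns-step : ∀ {k n} → (∀ n' → EventsOfRuns k n') → EventsOfRuns (suc k) n →
                    EventsOfRuns (suc k) (suc n)
EventsOfRuns-step shorter shallower {G} {S} {ρ} {α} ρ<k db bd ⊢S run = by-node (gnode G) refl
  where
    by-node : ∀ g → gnode G ≡ g → InE G (ev ρ α)
    by-node gend G≡ = ⊥-elim (End-no-participant {G = G} G≡ (sender-participates {G = G} ⊢S run))
    by-node (gcomm p q pq bs u) G≡ =
      events-at-comm shorter shallower G≡ (subst (TypedState S) G≡ ⊢S) ρ<k db bd run

events-of-runs : ∀ k n → EventsOfRuns k n
events-of-runs zero _ ()
events-of-runs (suc k) zero {G} _ db _ ⊢S run with sender-participates {G = G} ⊢S run
... | τ , t , s∈τ = contradiction (≤-trans (depth-pos s∈τ) (db τ t)) λ ()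
events-of-runs (suc k) (suc n) = EventsOfRuns-step (events-of-runs k) (events-of-runs (suc k) n)

inaction : Proc
pnode inaction = nil

inaction≼inaction : inaction ≼ inaction
_≼_.unfold≼ inaction≼inaction = nil≼

-- Participants outside N behave as 0.  Repeated names in N are harmless: typing covers every entry.
networkState : Network → State
networkState []            = λ _ → inaction
networkState ((p , P) ∷ N) = networkState N [ p ≔ P ]

networkState-lookup : ∀ N r → (r , networkState N r) ∈ N ⊎
                              (¬ r ∈ List.map proj₁ N × networkState N r ≡ inaction)
networkState-lookup [] r = inj₂ ((λ ()) , refl)
networkState-lookup ((p , P) ∷ N) r with r ≟ p | networkState-lookup N r
... | yes refl | _                  = inj₁ (here refl)
... | no  _    | inj₁ r∈N           = inj₁ (there r∈N)
... | no  r≢p  | inj₂ (r∉N , r↦0)  = inj₂ ((λ { (here r≡p) → r≢p r≡p ; (there r∈) → r∉N r∈ }) , r↦0)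

networkState-typed : ∀ {N} → Typed N G → TypedState (networkState N) (gnode G)
networkState-typed {N = N} (typed , participants) r with networkState-lookup N r
... | inj₁ r∈N with typed r _ r∈N
...   | Q , proj , P≼Q = Q , Proj.unfoldProj proj , P≼Q
networkState-typed {N = N} (typed , participants) r | inj₂ (r∉N , r↦0) =
  inaction , pj-zero (r∉N ∘ participants r) , subst (_≼ inaction) (sym r↦0) inaction≼inaction

events-included : ∀ {G G' N} → Bounded G' → Typed N G → Typed N G' → ∀ τ → InE G τ → InE G' τ
events-included {G' = G'} bd' ⊢G ⊢G' τ (σ , α , t , τ∼)
  with n , db ← depth-bound {G = G'} bd' (proj₁ α) =
  InE-resp-∼ {G = G'} τ∼
    (events-of-runs (suc (length σ)) n {G = G'} ≤-refl db bd'
       (networkState-typed ⊢G') (Run-of-trace (networkState-typed ⊢G) t))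

restrict-⟺ : ∀ {A B : Trace → Set} {R : Trace → Trace → Set} → (∀ τ → A τ ⟺ B τ) →
             ∀ τ τ' → (A τ × A τ' × R τ τ') ⟺ (B τ × B τ' × R τ τ')
restrict-⟺ A⟺B τ τ' =
  (λ (a , a' , r) → proj₁ (A⟺B τ) a , proj₁ (A⟺B τ') a' , r) ,
  (λ (b , b' , r) → proj₂ (A⟺B τ) b , proj₂ (A⟺B τ') b' , r)

mainTheorem2 : (G G' : Global) → RegularG G → RegularG G' →
               WellFormed G → WellFormed G' →
               (N : Network) → ValidNetwork N →
               Typed N G → Typed N G' →
               SameES G G'
mainTheorem2 G G' _ _ (_ , bounded) (_ , bounded') N _ ⊢G ⊢G' =
  same-events , restrict-⟺ same-events , restrict-⟺ same-events
  where
    same-events : ∀ τ → InE G τ ⟺ InE G' τ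
    same-events τ = events-included bounded' ⊢G ⊢G' τ , events-included bounded ⊢G' ⊢G τ
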